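{- Let $k\ge 1$ and let $L=(l_1,\ldots,l_k)$ be a sequence of positive integers, and let $S=S(L)$ be the spider with head $v_0$ and legs $S_i=v_0,v_{i,1},\ldots,v_{i,l_i}$ for $1\le i\le k$. Let $t$ be an integer with $t\le \alpha(S)$. Then for each $1\le i\le k$ and each $1\le j<l_i$ we have $$|\mathcal{I}^t_{v_{i,j}}(S)|\le |\mathcal{I}^t_{v_{i,l_i}}(S)|.$$
   Context: For a sequence of positive integers $L=(l_1,\ldots,l_k)$, the spider $S=S(L)$ is the tree consisting of a vertex $v_0$ (the head) together with, for each $1\le i\le k$, a path (leg) $S_i=v_0,v_{i,1},\ldots,v_{i,l_i}$, the legs sharing only $v_0$. For a graph $G$, $\alpha(G)$ denotes the maximum size of an independent set in $G$; for an integer $t\le\alpha(G)$, $\mathcal{I}^t(G)$ is the family of all independent sets of $G$ of size $t$, and for a vertex $x$, $\mathcal{I}^t_x(G)$ (the star centered at $x$) is the subfamily of those sets in $\mathcal{I}^t(G)$ that contain $x$. -}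

module Defs where

open import Data.Bool using (Bool; true; false; not; _∧_; _∨_; if_then_else_)
open import Data.Nat using (ℕ; zero; suc; _+_; _⊔_; _≡ᵇ_)
open import Data.List using (List; []; _∷_; map; concatMap; filterᵇ; length; foldr)
open import Data.Nat.ListAction using (sum)
open import Data.Product using (_×_; _,_)

-- A subset of the vertex set of the spider S(L), L = (l_1,...,l_k), is encoded
-- exactly (bijectively) as a pair (h , ls) where h says whether the head v_0 is
-- in the set, and ls is a list of k bit-lists; the i-th bit-list has length l_i
-- and its (j-1)-th entry says whether v_{i,j} is in the set.

SpiderSubset : Set
SpiderSubset = Bool × List (List Bool)

bits : ℕ → List (List Bool)
bits zero = [] ∷ []
bits (suc n) = concatMap (λ bs → (false ∷ bs) ∷ (true ∷ bs) ∷ []) (bits n)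

legConfigs : List ℕ → List (List (List Bool))
legConfigs [] = [] ∷ []
legConfigs (l ∷ L) = concatMap (λ b → map (b ∷_) (legConfigs L)) (bits l)

subsets : List ℕ → List SpiderSubset
subsets L = concatMap (λ h → map (h ,_) (legConfigs L)) (true ∷ false ∷ [])

noConsec : List Bool → Bool
noConsec [] = true
noConsec (true ∷ true ∷ bs) = false
noConsec (b ∷ bs) = noConsec bs

firstFalse : List Bool → Bool
firstFalse [] = true
firstFalse (b ∷ _) = not b

allᵇ : {A : Set} → (A → Bool) → List A → Bool
allᵇ p [] = true
allᵇ p (x ∷ xs) = p x ∧ allᵇ p xs

-- independence in S(L): edges are v_0 v_{i,1} and v_{i,j} v_{i,j+1}
independent : SpiderSubset → Bool
independent (h , ls) = allᵇ noConsec ls ∧ (not h ∨ allᵇ firstFalse ls)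

count : List Bool → ℕ
count bs = sum (map (λ b → if b then 1 else 0) bs)

size : SpiderSubset → ℕ
size (h , ls) = (if h then 1 else 0) + sum (map count ls)

-- default-false lookup
nth : List Bool → ℕ → Bool
nth [] _ = false
nth (b ∷ bs) zero = b
nth (b ∷ bs) (suc n) = nth bs n

legAt : List (List Bool) → ℕ → List Bool
legAt [] _ = []
legAt (x ∷ xs) zero = x
legAt (x ∷ xs) (suc n) = legAt xs n

-- does the subset contain v_{i+1,j}  (i is the 0-based leg index, j ≥ 1)
containsLeg : ℕ → ℕ → SpiderSubset → Bool
containsLeg i zero s = false
containsLeg i (suc j) (h , ls) = nth (legAt ls i) j

alpha : List ℕ → ℕ
alpha L = foldr _⊔_ 0 (map size (filterᵇ independent (subsets L)))

starSize : List ℕ → ℕ → ℕ → ℕ → ℕ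
starSize L t i j =
  length (filterᵇ (λ s → independent s ∧ (size s ≡ᵇ t) ∧ containsLeg i j s) (subsets L))

module Submission where

-- Write j = n + 1 < l = l_i.  Every independent set I containing
-- v_{i,j} omits v_{i,j+1}.  Deleting these two vertices from leg i and appending
-- "v not chosen, v chosen" at its far end gives a set of the same size that is
-- still independent and contains the tip v_{i,l}; the original set is recovered
-- from the image because the pivot position n is fixed.  This injection between
-- the stars I^t_{v_{i,j}} and I^t_{v_{i,l}} yields the inequality.

open import Defs
open import Data.Nat using (ℕ; _≤_; _<_)
open import Data.List using (List; length; lookup)
open import Data.List.Relation.Unary.All using (All)
open import Data.Fin using (Fin; toℕ)

open import Data.Bool using (Bool; true; false; _∧_; _∨_; T; if_then_else_)
open import Data.Bool.Properties using (T-∧; T-∨)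
open import Data.Empty using (⊥-elim)
open import Data.Fin using (zero; suc)
open import Data.List using ([]; _∷_; _++_; map; concatMap; cartesianProductWith; cartesianProduct; filterᵇ)
open import Data.List.Properties using (∷-injective; ∷-injectiveˡ; ∷-injectiveʳ; length-++; ++-cancelʳ)
open import Data.List.Membership.Propositional using (_∈_)
open import Data.List.Membership.Propositional.Properties
  using (∈-∃++; ∈-cartesianProductWith⁺; ∈-cartesianProductWith⁻; ∈-cartesianProduct⁺; ∈-cartesianProduct⁻; ∈-filter⁺; ∈-filter⁻)
open import Data.List.Relation.Unary.Any using (here; there)
import Data.List.Relation.Unary.All as All
open import Data.List.Relation.Unary.AllPairs using ([]; _∷_)
open import Data.List.Relation.Unary.Unique.Propositional using (Unique)
open import Data.List.Relation.Unary.Unique.Propositional.Properties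
  using (cartesianProductWith⁺; cartesianProduct⁺; filter⁺)
open import Data.Nat using (zero; suc; _+_; _≡ᵇ_; z≤n; s≤s)
open import Data.Nat.ListAction using (sum)
open import Data.Nat.Properties using (+-suc; module ≤-Reasoning)
open import Data.Product as Product using (_×_; _,_; proj₁; proj₂)
open import Data.Product.Properties using (,-injectiveˡ; ,-injectiveʳ)
import Data.Sum as Sum
open import Function using (_∘_; id; Equivalence)
open import Relation.Binary.PropositionalEquality using (_≡_; _≢_; refl; sym; trans; cong; cong₂; subst)
open import Relation.Nullary.Decidable using (T?)

open Equivalence using (to; from)

∧-mono : ∀ {a a′ b b′} → (T a → T a′) → (T b → T b′) → T (a ∧ b) → T (a′ ∧ b′)
∧-mono f g ab = from T-∧ (Product.map f g (to T-∧ ab))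

∨-mono : ∀ {a a′ b b′} → (T a → T a′) → (T b → T b′) → T (a ∨ b) → T (a′ ∨ b′)
∨-mono f g ab = from T-∨ (Sum.map f g (to T-∨ ab))

∈-remove : {A : Set} {z w : A} (as bs : List A) → z ∈ as ++ w ∷ bs → z ≢ w → z ∈ as ++ bs
∈-remove []       bs (here z≡w)   z≢w = ⊥-elim (z≢w z≡w)
∈-remove []       bs (there z∈bs) _   = z∈bs
∈-remove (a ∷ as) bs (here z≡a)   _   = here z≡a
∈-remove (a ∷ as) bs (there z∈)   z≢w = there (∈-remove as bs z∈ z≢w)

injection-length : {A B : Set} (f : A → B) {xs : List A} {ys : List B} → Unique xs →
  (∀ {x} → x ∈ xs → f x ∈ ys) →
  (∀ {x y} → x ∈ xs → y ∈ xs → f x ≡ f y → x ≡ y) →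
  length xs ≤ length ys
injection-length f {[]}     _                  _    _   = z≤n
injection-length f {x ∷ xs} (x≢xs ∷ xs-unique) into inj
  with as , bs , refl ← ∈-∃++ (into (here refl)) =
  begin
    suc (length xs)                ≤⟨ s≤s (injection-length f xs-unique into′ inj′) ⟩
    suc (length (as ++ bs))        ≡⟨ cong suc (length-++ as) ⟩
    suc (length as + length bs)    ≡⟨ +-suc (length as) (length bs) ⟨
    length as + length (f x ∷ bs)  ≡⟨ length-++ as ⟨
    length (as ++ f x ∷ bs)        ∎
  where
  open ≤-Reasoning
  into′ : ∀ {y} → y ∈ xs → f y ∈ as ++ bs
  into′ y∈xs = ∈-remove as bs (into (there y∈xs))
    (λ fy≡fx → All.lookup x≢xs y∈xs (sym (inj (there y∈xs) (here refl) fy≡fx)))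
  inj′ : ∀ {y z} → y ∈ xs → z ∈ xs → f y ≡ f z → y ≡ z
  inj′ y∈xs z∈xs = inj (there y∈xs) (there z∈xs)

concatMap-rows : {A B C : Set} (f : A → B → C) (xs : List A) (ys : List B) →
  concatMap (λ x → map (f x) ys) xs ≡ cartesianProductWith f xs ys
concatMap-rows f []       ys = refl
concatMap-rows f (x ∷ xs) ys = cong (map (f x) ys ++_) (concatMap-rows f xs ys)

bits-grid : ∀ n → bits (suc n) ≡ cartesianProductWith (λ bs b → b ∷ bs) (bits n) (false ∷ true ∷ [])
bits-grid n = concatMap-rows (λ bs b → b ∷ bs) (bits n) (false ∷ true ∷ [])

legConfigs-grid : ∀ l L → legConfigs (l ∷ L) ≡ cartesianProductWith _∷_ (bits l) (legConfigs L)
legConfigs-grid l L = concatMap-rows _∷_ (bits l) (legConfigs L)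

subsets-grid : ∀ L → subsets L ≡ cartesianProduct (true ∷ false ∷ []) (legConfigs L)
subsets-grid L = concatMap-rows _,_ (true ∷ false ∷ []) (legConfigs L)

∈-falseTrue : ∀ b → b ∈ false ∷ true ∷ []
∈-falseTrue false = here refl
∈-falseTrue true  = there (here refl)

∈-trueFalse : ∀ b → b ∈ true ∷ false ∷ []
∈-trueFalse true  = here refl
∈-trueFalse false = there (here refl)

falseTrue-unique : Unique (false ∷ true ∷ [])
falseTrue-unique = ((λ ()) All.∷ All.[]) ∷ All.[] ∷ []

trueFalse-unique : Unique (true ∷ false ∷ [])
trueFalse-unique = ((λ ()) All.∷ All.[]) ∷ All.[] ∷ []

bits-length : ∀ n {x} → x ∈ bits n → length x ≡ n
bits-length zero    (here refl) = refl
bits-length (suc n) x∈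
  with _ , _ , bs∈ , _ , refl ← ∈-cartesianProductWith⁻ _ (bits n) _ (subst (_ ∈_) (bits-grid n) x∈)
  = cong suc (bits-length n bs∈)

∈-bits : ∀ x → x ∈ bits (length x)
∈-bits []      = here refl
∈-bits (b ∷ x) = subst (b ∷ x ∈_) (sym (bits-grid (length x)))
  (∈-cartesianProductWith⁺ (λ bs b → b ∷ bs) (∈-bits x) (∈-falseTrue b))

bits-unique : ∀ n → Unique (bits n)
bits-unique zero    = All.[] ∷ []
bits-unique (suc n) = subst Unique (sym (bits-grid n))
  (cartesianProductWith⁺ _ (λ eq → ∷-injectiveʳ eq , ∷-injectiveˡ eq) (bits-unique n) falseTrue-unique)

legConfigs-shape : ∀ L {ls} → ls ∈ legConfigs L → map length ls ≡ L
legConfigs-shape []      (here refl) = refl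
legConfigs-shape (l ∷ L) ls∈
  with _ , _ , x∈ , ls′∈ , refl ← ∈-cartesianProductWith⁻ _∷_ (bits l) _ (subst (_ ∈_) (legConfigs-grid l L) ls∈)
  = cong₂ _∷_ (bits-length l x∈) (legConfigs-shape L ls′∈)

∈-legConfigs : ∀ ls → ls ∈ legConfigs (map length ls)
∈-legConfigs []       = here refl
∈-legConfigs (x ∷ ls) = subst (x ∷ ls ∈_) (sym (legConfigs-grid (length x) (map length ls)))
  (∈-cartesianProductWith⁺ _∷_ (∈-bits x) (∈-legConfigs ls))

legConfigs-unique : ∀ L → Unique (legConfigs L)
legConfigs-unique []      = All.[] ∷ []
legConfigs-unique (l ∷ L) = subst Unique (sym (legConfigs-grid l L))
  (cartesianProductWith⁺ _∷_ ∷-injective (bits-unique l) (legConfigs-unique L))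

subsets-shape : ∀ L {h ls} → (h , ls) ∈ subsets L → map length ls ≡ L
subsets-shape L s∈ = legConfigs-shape L (proj₂ (∈-cartesianProduct⁻ (true ∷ false ∷ []) (legConfigs L) (subst (_ ∈_) (subsets-grid L) s∈)))

∈-subsets : ∀ h ls → (h , ls) ∈ subsets (map length ls)
∈-subsets h ls = subst ((h , ls) ∈_) (sym (subsets-grid (map length ls)))
  (∈-cartesianProduct⁺ (∈-trueFalse h) (∈-legConfigs ls))

subsets-unique : ∀ L → Unique (subsets L)
subsets-unique L = subst Unique (sym (subsets-grid L))
  (cartesianProduct⁺ trueFalse-unique (legConfigs-unique L))

data Pivot : ℕ → List Bool → Set where
  at   : ∀ suf → Pivot zero (true ∷ false ∷ suf)
  past : ∀ {n x} b → Pivot n x → Pivot (suc n) (b ∷ x)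

noConsec-tail : ∀ b x → T (noConsec (b ∷ x)) → T (noConsec x)
noConsec-tail false x         nc = nc
noConsec-tail true  []        nc = nc
noConsec-tail true  (true ∷ x) ()
noConsec-tail true  (false ∷ x) nc = nc

pivot : ∀ n x → suc n < length x → T (nth x n) → T (noConsec x) → Pivot n x
pivot zero    (true ∷ false ∷ suf) _       _      _  = at suf
pivot zero    (true ∷ true ∷ suf)  _       _      ()
pivot zero    (true ∷ [])          (s≤s ()) _     _
pivot zero    (false ∷ x)          _       ()     _
pivot (suc n) (b ∷ x)              (s≤s n<) chosen nc = past b (pivot n x n< chosen (noConsec-tail b x nc))

moveToEnd : ℕ → List Bool → List Bool
moveToEnd zero    (_ ∷ _ ∷ suf) = suf ++ false ∷ true ∷ []
moveToEnd (suc n) (b ∷ x)       = b ∷ moveToEnd n x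
moveToEnd _       x             = x

length-++-tip : ∀ ys → length (ys ++ false ∷ true ∷ []) ≡ suc (suc (length ys))
length-++-tip []       = refl
length-++-tip (y ∷ ys) = cong suc (length-++-tip ys)

count-++-tip : ∀ ys → count (ys ++ false ∷ true ∷ []) ≡ suc (count ys)
count-++-tip []           = refl
count-++-tip (false ∷ ys) = count-++-tip ys
count-++-tip (true ∷ ys)  = cong suc (count-++-tip ys)

noConsec-++-tip : ∀ ys → T (noConsec ys) → T (noConsec (ys ++ false ∷ true ∷ []))
noConsec-++-tip []                  nc = nc
noConsec-++-tip (false ∷ ys)        nc = noConsec-++-tip ys nc
noConsec-++-tip (true ∷ [])         nc = nc
noConsec-++-tip (true ∷ true ∷ ys)  ()
noConsec-++-tip (true ∷ false ∷ ys) nc = noConsec-++-tip (false ∷ ys) nc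

nth-++-tip : ∀ ys → T (nth (ys ++ false ∷ true ∷ []) (suc (length ys)))
nth-++-tip []       = _
nth-++-tip (y ∷ ys) = nth-++-tip ys

moveToEnd-length : ∀ {n x} → Pivot n x → length (moveToEnd n x) ≡ length x
moveToEnd-length (at suf)   = length-++-tip suf
moveToEnd-length (past b p) = cong suc (moveToEnd-length p)

moveToEnd-count : ∀ {n x} → Pivot n x → count (moveToEnd n x) ≡ count x
moveToEnd-count (at suf)       = count-++-tip suf
moveToEnd-count (past false p) = moveToEnd-count p
moveToEnd-count (past true p)  = cong suc (moveToEnd-count p)

moveToEnd-noConsec : ∀ {n x} → Pivot n x → T (noConsec x) → T (noConsec (moveToEnd n x))
moveToEnd-noConsec (at suf)                    nc = noConsec-++-tip suf nc
moveToEnd-noConsec (past false p)              nc = moveToEnd-noConsec p nc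
moveToEnd-noConsec (past true (at suf))        ()
moveToEnd-noConsec (past true (past false p)) nc = moveToEnd-noConsec (past false p) nc
moveToEnd-noConsec (past true (past true p))  ()

-- The first vertex changes only when it is the pivot, which then is chosen.
moveToEnd-firstFalse : ∀ {n x} → Pivot n x → T (firstFalse x) → T (firstFalse (moveToEnd n x))
moveToEnd-firstFalse (at suf)   ()
moveToEnd-firstFalse (past b p) ff = ff

moveToEnd-tip : ∀ {n x m} → Pivot n x → length x ≡ suc m → T (nth (moveToEnd n x) m)
moveToEnd-tip (at suf)              refl = nth-++-tip suf
moveToEnd-tip (past b (at suf))     refl = nth-++-tip suf
moveToEnd-tip (past b (past c p))   refl = moveToEnd-tip (past c p) refl

moveToEnd-injective : ∀ {n x y} → Pivot n x → Pivot n y → moveToEnd n x ≡ moveToEnd n y → x ≡ y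
moveToEnd-injective (at suf)   (at suf′)  eq = cong (λ s → true ∷ false ∷ s) (++-cancelʳ _ suf suf′ eq)
moveToEnd-injective (past b p) (past c q) eq =
  cong₂ _∷_ (∷-injectiveˡ eq) (moveToEnd-injective p q (∷-injectiveʳ eq))

-- Apply f to the i-th element of a list (no change if the index is too large).
modifyAt : {A : Set} → ℕ → (A → A) → List A → List A
modifyAt _       f []       = []
modifyAt zero    f (x ∷ xs) = f x ∷ xs
modifyAt (suc i) f (x ∷ xs) = x ∷ modifyAt i f xs

legAt-modifyAt : ∀ {f} i ls → i < length ls → legAt (modifyAt i f ls) i ≡ f (legAt ls i)
legAt-modifyAt zero    (x ∷ ls) _        = refl
legAt-modifyAt (suc i) (x ∷ ls) (s≤s i<) = legAt-modifyAt i ls i<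

map-modifyAt : {B : Set} (g : List Bool → B) {f : List Bool → List Bool} → ∀ i ls →
  g (f (legAt ls i)) ≡ g (legAt ls i) → map g (modifyAt i f ls) ≡ map g ls
map-modifyAt g zero    []       _  = refl
map-modifyAt g (suc i) []       _  = refl
map-modifyAt g zero    (x ∷ ls) eq = cong (_∷ map g ls) eq
map-modifyAt g (suc i) (x ∷ ls) eq = cong (g x ∷_) (map-modifyAt g i ls eq)

allᵇ-modifyAt : (p : List Bool → Bool) {f : List Bool → List Bool} → ∀ i ls →
  (T (p (legAt ls i)) → T (p (f (legAt ls i)))) → T (allᵇ p ls) → T (allᵇ p (modifyAt i f ls))
allᵇ-modifyAt p zero    []       _    all = all
allᵇ-modifyAt p (suc i) []       _    all = all
allᵇ-modifyAt p zero    (x ∷ ls) pres      = ∧-mono pres id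
allᵇ-modifyAt p (suc i) (x ∷ ls) pres      = ∧-mono id (allᵇ-modifyAt p i ls pres)

allᵇ-legAt : (p : List Bool → Bool) → ∀ i ls → i < length ls → T (allᵇ p ls) → T (p (legAt ls i))
allᵇ-legAt p zero    (x ∷ ls) _        all = proj₁ (to T-∧ all)
allᵇ-legAt p (suc i) (x ∷ ls) (s≤s i<) all = allᵇ-legAt p i ls i< (proj₂ (to T-∧ all))

modifyAt-injective : ∀ {f} i ls ls′ → (f (legAt ls i) ≡ f (legAt ls′ i) → legAt ls i ≡ legAt ls′ i) →
  modifyAt i f ls ≡ modifyAt i f ls′ → ls ≡ ls′
modifyAt-injective _       []       []         _   _  = refl
modifyAt-injective zero    (x ∷ ls) (x′ ∷ ls′) inj eq = cong₂ _∷_ (inj (∷-injectiveˡ eq)) (∷-injectiveʳ eq)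
modifyAt-injective (suc i) (x ∷ ls) (x′ ∷ ls′) inj eq =
  cong₂ _∷_ (∷-injectiveˡ eq) (modifyAt-injective i ls ls′ inj (∷-injectiveʳ eq))
modifyAt-injective zero    []       (_ ∷ _)    _   ()
modifyAt-injective (suc i) []       (_ ∷ _)    _   ()
modifyAt-injective zero    (_ ∷ _)  []         _   ()
modifyAt-injective (suc i) (_ ∷ _)  []         _   ()

inStar : ℕ → ℕ → ℕ → SpiderSubset → Bool
inStar t i j s = independent s ∧ (size s ≡ᵇ t) ∧ containsLeg i j s

moveOnLeg : ℕ → ℕ → SpiderSubset → SpiderSubset
moveOnLeg i n (h , ls) = h , modifyAt i (moveToEnd n) ls

shape-index : ∀ {ls : List (List Bool)} {L} → map length ls ≡ L → (i : Fin (length L)) → toℕ i < length ls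
shape-index {x ∷ ls} refl zero    = s≤s z≤n
shape-index {x ∷ ls} refl (suc i) = s≤s (shape-index {ls} refl i)

shape-legAt : ∀ {ls : List (List Bool)} {L} → map length ls ≡ L → (i : Fin (length L)) → length (legAt ls (toℕ i)) ≡ lookup L i
shape-legAt {x ∷ ls} refl zero    = refl
shape-legAt {x ∷ ls} refl (suc i) = shape-legAt {ls} refl i

star-pivot : ∀ {L t h ls n} (i : Fin (length L)) → map length ls ≡ L → suc n < lookup L i →
  T (inStar t (toℕ i) (suc n) (h , ls)) → Pivot n (legAt ls (toℕ i))
star-pivot {t = t} {h} {ls} {n} i shape n< star =
  pivot n (legAt ls (toℕ i)) (subst (suc n <_) (sym (shape-legAt shape i)) n<) chosen noConsec-leg
  where
  parts : T (independent (h , ls)) × T ((size (h , ls) ≡ᵇ t) ∧ containsLeg (toℕ i) (suc n) (h , ls))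
  parts = to T-∧ star
  chosen : T (nth (legAt ls (toℕ i)) n)
  chosen = proj₂ (to T-∧ (proj₂ parts))
  noConsec-leg : T (noConsec (legAt ls (toℕ i)))
  noConsec-leg = allᵇ-legAt noConsec (toℕ i) ls (shape-index shape i) (proj₁ (to T-∧ (proj₁ parts)))

moveOnLeg-shape : ∀ {i n} h ls → Pivot n (legAt ls i) → map length (proj₂ (moveOnLeg i n (h , ls))) ≡ map length ls
moveOnLeg-shape {i} h ls p = map-modifyAt length i ls (moveToEnd-length p)

moveOnLeg-size : ∀ {i n} h ls → Pivot n (legAt ls i) → size (moveOnLeg i n (h , ls)) ≡ size (h , ls)
moveOnLeg-size {i} h ls p = cong (λ cs → (if h then 1 else 0) + sum cs) (map-modifyAt count i ls (moveToEnd-count p))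

moveOnLeg-independent : ∀ {i n} h ls → Pivot n (legAt ls i) →
  T (independent (h , ls)) → T (independent (moveOnLeg i n (h , ls)))
moveOnLeg-independent {i} h ls p =
  ∧-mono (allᵇ-modifyAt noConsec i ls (moveToEnd-noConsec p))
         (∨-mono id (allᵇ-modifyAt firstFalse i ls (moveToEnd-firstFalse p)))

moveOnLeg-tip : ∀ {i n l} h ls → i < length ls → Pivot n (legAt ls i) → suc n < l → length (legAt ls i) ≡ l →
  T (containsLeg i l (moveOnLeg i n (h , ls)))
moveOnLeg-tip {i} {l = suc m} h ls i< p _ len =
  subst (λ leg → T (nth leg m)) (sym (legAt-modifyAt i ls i<)) (moveToEnd-tip p len)

moveOnLeg-star : ∀ {L t h ls n} (i : Fin (length L)) → map length ls ≡ L → suc n < lookup L i →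
  Pivot n (legAt ls (toℕ i)) →
  T (inStar t (toℕ i) (suc n) (h , ls)) → T (inStar t (toℕ i) (lookup L i) (moveOnLeg (toℕ i) n (h , ls)))
moveOnLeg-star {t = t} {h} {ls} i shape n< p =
  ∧-mono (moveOnLeg-independent h ls p)
    (∧-mono (subst (λ k → T (k ≡ᵇ t)) (sym (moveOnLeg-size h ls p)))
            (λ _ → moveOnLeg-tip h ls (shape-index shape i) p n< (shape-legAt shape i)))

moveOnLeg-injective : ∀ {i n h h′ ls ls′} → Pivot n (legAt ls i) → Pivot n (legAt ls′ i) →
  moveOnLeg i n (h , ls) ≡ moveOnLeg i n (h′ , ls′) → (h , ls) ≡ (h′ , ls′)
moveOnLeg-injective {i} {n} {ls = ls} {ls′ = ls′} p p′ eq =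
  cong₂ _,_ (,-injectiveˡ eq) (modifyAt-injective {f = moveToEnd n} i ls ls′ (moveToEnd-injective p p′) (,-injectiveʳ eq))

star-mono : ∀ L t (i : Fin (length L)) n → suc n < lookup L i →
  starSize L t (toℕ i) (suc n) ≤ starSize L t (toℕ i) (lookup L i)
star-mono L t i n n< = injection-length (moveOnLeg (toℕ i) n) (filter⁺ (T? ∘ source) (subsets-unique L)) into inj
  where
  source target : SpiderSubset → Bool
  source = inStar t (toℕ i) (suc n)
  target = inStar t (toℕ i) (lookup L i)

  member : ∀ {h ls} → (h , ls) ∈ filterᵇ source (subsets L) →
    map length ls ≡ L × Pivot n (legAt ls (toℕ i)) × T (source (h , ls))
  member s∈ with s∈L , star ← ∈-filter⁻ (T? ∘ source) s∈ =
    let shape = subsets-shape L s∈L in shape , star-pivot i shape n< star , star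

  into : ∀ {s} → s ∈ filterᵇ source (subsets L) → moveOnLeg (toℕ i) n s ∈ filterᵇ target (subsets L)
  into {h , ls} s∈ with shape , p , star ← member s∈ =
    ∈-filter⁺ (T? ∘ target)
      (subst (moveOnLeg (toℕ i) n (h , ls) ∈_) (cong subsets (trans (moveOnLeg-shape h ls p) shape))
        (∈-subsets h (modifyAt (toℕ i) (moveToEnd n) ls)))
      (moveOnLeg-star i shape n< p star)

  inj : ∀ {s s′} → s ∈ filterᵇ source (subsets L) → s′ ∈ filterᵇ source (subsets L) →
    moveOnLeg (toℕ i) n s ≡ moveOnLeg (toℕ i) n s′ → s ≡ s′
  inj {_ , _} {_ , _} s∈ s′∈ = moveOnLeg-injective (proj₁ (proj₂ (member s∈))) (proj₁ (proj₂ (member s′∈)))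

theorem1 : (L : List ℕ) → 1 ≤ length L → All (1 ≤_) L →
    (t : ℕ) → t ≤ alpha L →
    (i : Fin (length L)) → (j : ℕ) → 1 ≤ j → j < lookup L i →
    starSize L t (toℕ i) j ≤ starSize L t (toℕ i) (lookup L i)
theorem1 L _ _ t _ i (suc n) _ n< = star-mono L t i n n<
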